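{- Let $(I,f_l,f_u)$ be an admissible restriction and $\mathbf{C}=\mathbf{C}(I,f_l,f_u)$. Then $l^\star=\mathbf{C}^{(k')}$ with $k'=k-\sum_{i\in I}(f_l(i)-1)$.
   Context: Let $\mathbf{L}=\{L_1,\dots,L_n\}$ be a multiset of positive rationals and $k\in\mathbb{N}_{>0}$. Let $m(l)=\sum_i\lfloor L_i/l\rfloor$; $l$ is feasible if $m(l)\ge k$, infeasible otherwise; $l^\star=\max\{l\in\mathbb{Q}_{>0}\mid m(l)\ge k\}$. For $I\subseteq[1..n]$, $f_l:I\to\mathbb{N}$, $f_u:I\to\mathbb{N}$, let $\mathbf{C}(I,f_l,f_u)=\biguplus_{i\in I}\{L_i/j\mid f_l(i)\le j\le f_u(i)\}$ (multiset union). $(I,f_l,f_u)$ is admissible if for all $i\in I$: $f_l(i)=1$ or $L_i/(f_l(i)-1)$ is infeasible; $L_i/f_u(i)$ is feasible; and for all $i'\in[1..n]\setminus I$, $L_{i'}$ is feasible and $L_{i'}\ne l^\star$. $\mathbf{A}^{(r)}$ denotes the $r$-th largest element of multiset $\mathbf{A}$ counting multiplicities. -}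

module Defs where

open import Data.Nat as ℕ using (ℕ; zero; suc; _∸_)
open import Data.Integer as ℤ using (ℤ; +_)
open import Data.Rational using (ℚ; _*_; _÷_; _/_; floor; Positive; NonZero; _≤_)
open import Data.Rational.Properties using (pos⇒nonZero; ≤-decTotalOrder)
open import Data.Fin using (Fin)
open import Data.Fin.Subset using (Subset; _∈_; _∉_)
open import Data.Fin.Subset.Properties using (_∈?_)
open import Data.List using (List; []; _∷_; map; concatMap; reverse; allFin; upTo; filter)
open import Data.List.Sort ≤-decTotalOrder using (sort)
open import Data.Maybe using (Maybe; just; nothing)
open import Data.Product using (Σ; _×_)
open import Relation.Nullary using (¬_)
open import Relation.Binary.PropositionalEquality using (_≡_)
open import Data.Sum using (_⊎_)

-- L / j for a positive natural j (the value for j = 0 is an unused dummy 0).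
_/ℕ_ : ℚ → ℕ → ℚ
L /ℕ zero    = + 0 / 1
L /ℕ (suc j) = L * (+ 1 / suc j)

sumℤ : List ℤ → ℤ
sumℤ []       = + 0
sumℤ (x ∷ xs) = x ℤ.+ sumℤ xs

sumℕ : List ℕ → ℕ
sumℕ []       = 0
sumℕ (x ∷ xs) = x ℕ.+ sumℕ xs

m : {n : ℕ} → (Fin n → ℚ) → (l : ℚ) → .{{_ : NonZero l}} → ℤ
m {n} L l = sumℤ (map (λ i → floor (L i ÷ l)) (allFin n))

Feasible : {n : ℕ} → (Fin n → ℚ) → ℕ → ℚ → Set
Feasible L k l = Σ (Positive l) λ p → + k ℤ.≤ m L l {{pos⇒nonZero l {{p}}}}

Infeasible : {n : ℕ} → (Fin n → ℚ) → ℕ → ℚ → Set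
Infeasible L k l = ¬ Feasible L k l

IsLStar : {n : ℕ} → (Fin n → ℚ) → ℕ → ℚ → Set
IsLStar L k l⋆ = Feasible L k l⋆ × (∀ l → Feasible L k l → l ≤ l⋆)

elems : {n : ℕ} → Subset n → List (Fin n)
elems {n} I = filter (_∈? I) (allFin n)

-- the list [a, a+1, ..., b] (empty if b < a)
range : ℕ → ℕ → List ℕ
range a b = map (a ℕ.+_) (upTo (suc b ∸ a))

-- the multiset C(I, f_l, f_u) = ⊎_{i∈I} { L_i / j | f_l(i) ≤ j ≤ f_u(i) }, as a list
Cset : {n : ℕ} → (Fin n → ℚ) → Subset n → (Fin n → ℕ) → (Fin n → ℕ) → List ℚ
Cset L I fl fu = concatMap (λ i → map (L i /ℕ_) (range (fl i) (fu i))) (elems I)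

record Admissible {n : ℕ} (L : Fin n → ℚ) (k : ℕ) (l⋆ : ℚ)
                  (I : Subset n) (fl fu : Fin n → ℕ) : Set where
  field
    lower : ∀ i → i ∈ I → fl i ≡ 1 ⊎ Infeasible L k (L i /ℕ (fl i ∸ 1))
    upper : ∀ i → i ∈ I → Feasible L k (L i /ℕ fu i)
    outside : ∀ i → i ∉ I → Feasible L k (L i) × ¬ (L i ≡ l⋆)

_!!_ : {A : Set} → List A → ℕ → Maybe A
[]       !! _       = nothing
(x ∷ xs) !! zero    = just x
(x ∷ xs) !! (suc r) = xs !! r

-- A^(r): the r-th largest element of A counting multiplicities (1-based r);
-- nothing if r = 0 or r > |A|
_⁽_⁾ : List ℚ → ℕ → Maybe ℚ
A ⁽ zero ⁾  = nothing
A ⁽ suc r ⁾ = reverse (sort A) !! r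

-- Let s = Σ_{i∈I} (f_l(i) − 1) and let c_> and c_≥ count the elements of C that are > l⋆ and ≥ l⋆.
-- Sorted decreasingly, C lists its elements > l⋆ first and its copies of l⋆ next, so C^(r) = l⋆
-- exactly when c_> < r ≤ c_≥; it therefore suffices to show s + c_> < k ≤ s + c_≥.
-- Now ⌊L_i/l⋆⌋ counts the j ≥ 1 with j·l⋆ ≤ L_i, an initial segment of ℕ. Admissibility says that
-- every j < f_l(i) even has j·l⋆ < L_i, that no j > f_u(i) has j·l⋆ ≤ L_i, and that for i ∉ I no
-- j ≥ 1 does. Hence ⌊L_i/l⋆⌋ ≤ f_l(i) − 1 + #{j ∈ [f_l(i), f_u(i)] | l⋆ ≤ L_i/j}, and summing gives
-- k ≤ m(l⋆) ≤ s + c_≥. Dually g_i = f_l(i) − 1 + #{j ∈ [f_l(i), f_u(i)] | l⋆ < L_i/j} satisfies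
-- g_i·l⋆ < L_i, so some y > l⋆ still has g_i·y ≤ L_i for all i ∈ I; then m(y) ≥ Σ g_i = s + c_>,
-- and since y > l⋆ is infeasible, s + c_> < k.

module Submission where

open import Defs
open import Data.Nat as ℕ using (ℕ; zero; suc; _≤_; _<_; _∸_; z≤n)
import Data.Nat.Properties as ℕ
open import Algebra.Properties.CommutativeSemigroup ℕ.+-commutativeSemigroup using (interchange)
open import Data.Nat.DivMod using (m/n*n≤m; m*n/n≡m; /-monoˡ-≤)
open import Data.Integer as ℤ using (ℤ; +_; +[1+_]; +≤+; +<+)
import Data.Integer.Properties as ℤ
open import Data.Integer.DivMod using (div-pos-is-/ℕ)
open import Data.Rational as ℚ using (ℚ; mkℚ; floor; Positive; _÷_; 1/_; ↥_; ↧ₙ_; toℚᵘ; 1ℚ)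
import Data.Rational.Properties as ℚ
open import Data.Rational.Unnormalised as ℚᵘ using (mkℚᵘ; *≤*; *<*)
import Data.Rational.Unnormalised.Properties as ℚᵘ
open import Data.Fin using (Fin)
open import Data.Fin.Subset using (Subset; _∈_; _∉_)
open import Data.Fin.Subset.Properties using (_∈?_)
open import Data.List using (List; []; _∷_; _++_; map; filter; length; reverse; concatMap; allFin; applyUpTo)
import Data.List.Properties as List
open import Data.List.Relation.Unary.All as All using (All; []; _∷_)
open import Data.List.Relation.Unary.All.Properties using (all-filter)
open import Data.List.Relation.Unary.AllPairs as AllPairs using (AllPairs; []; _∷_)
import Data.List.Relation.Unary.AllPairs.Properties as AllPairs
open import Data.List.Relation.Unary.Linked.Properties using (Linked⇒AllPairs)
open import Data.List.Relation.Binary.Permutation.Propositional using (_↭_; ↭-sym)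
open import Data.List.Relation.Binary.Permutation.Propositional.Properties
  using (↭-length; filter-↭; ↭-reverse; All-resp-↭)
open import Data.List.Sort ℚ.≤-decTotalOrder using (sort; sort-↭; sort-↗)
open import Data.Maybe using (just)
open import Data.Product using (∃-syntax; _×_; _,_; proj₁; proj₂)
open import Data.Sum using (inj₁; inj₂)
open import Data.Empty using (⊥-elim)
open import Function using (_∘_; flip; _⇔_; mk⇔; Equivalence)
import Function.Properties.Equivalence as ⇔
open import Relation.Nullary using (¬_; yes; no)
open import Relation.Unary using (Decidable)
open import Relation.Binary.PropositionalEquality

open Equivalence

private
  variable
    A B : Set

count : {P : A → Set} → Decidable P → List A → ℕ
count P? = length ∘ filter P?

module _ {P : A → Set} (P? : Decidable P) where

  count-accept : ∀ {x xs} → P x → count P? (x ∷ xs) ≡ suc (count P? xs)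
  count-accept = cong length ∘ List.filter-accept P?

  count-reject : ∀ {x xs} → ¬ P x → count P? (x ∷ xs) ≡ count P? xs
  count-reject = cong length ∘ List.filter-reject P?

  count-none : ∀ {xs} → All (¬_ ∘ P) xs → count P? xs ≡ 0
  count-none = cong length ∘ List.filter-none P?

  count-++ : ∀ xs ys → count P? (xs ++ ys) ≡ count P? xs ℕ.+ count P? ys
  count-++ xs ys = trans (cong length (List.filter-++ P? xs ys)) (List.length-++ (filter P? xs))

  count-↭ : ∀ {xs ys} → xs ↭ ys → count P? xs ≡ count P? ys
  count-↭ = ↭-length ∘ filter-↭ P?

  sum-+-count : (f : B → ℕ) (g : B → List A) → ∀ xs →
                sumℕ (map (λ x → f x ℕ.+ count P? (g x)) xs) ≡ sumℕ (map f xs) ℕ.+ count P? (concatMap g xs)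
  sum-+-count f g [] = refl
  sum-+-count f g (x ∷ xs) = begin
    (f x ℕ.+ count P? (g x)) ℕ.+ sumℕ (map (λ x → f x ℕ.+ count P? (g x)) xs)
      ≡⟨ cong ((f x ℕ.+ count P? (g x)) ℕ.+_) (sum-+-count f g xs) ⟩
    (f x ℕ.+ count P? (g x)) ℕ.+ (sumℕ (map f xs) ℕ.+ count P? (concatMap g xs))
      ≡⟨ interchange (f x) _ _ _ ⟩
    (f x ℕ.+ sumℕ (map f xs)) ℕ.+ (count P? (g x) ℕ.+ count P? (concatMap g xs))
      ≡⟨ cong ((f x ℕ.+ sumℕ (map f xs)) ℕ.+_) (count-++ (g x) (concatMap g xs)) ⟨
    (f x ℕ.+ sumℕ (map f xs)) ℕ.+ count P? (g x ++ concatMap g xs) ∎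
    where open ≡-Reasoning

sum-mono-All : {f g : A → ℕ} {xs : List A} → All (λ x → f x ≤ g x) xs → sumℕ (map f xs) ≤ sumℕ (map g xs)
sum-mono-All [] = z≤n
sum-mono-All (f≤g ∷ fs≤gs) = ℕ.+-mono-≤ f≤g (sum-mono-All fs≤gs)

module _ {P : A → Set} (P? : Decidable P) (f : A → ℕ) where

  sum-filter-≤ : ∀ xs → sumℕ (map f (filter P? xs)) ≤ sumℕ (map f xs)
  sum-filter-≤ [] = z≤n
  sum-filter-≤ (x ∷ xs) with P? x
  ... | yes _ = ℕ.+-monoʳ-≤ (f x) (sum-filter-≤ xs)
  ... | no _ = ℕ.m≤n⇒m≤o+n (f x) (sum-filter-≤ xs)

  sum-filter-≡ : (∀ x → ¬ P x → f x ≡ 0) → ∀ xs → sumℕ (map f (filter P? xs)) ≡ sumℕ (map f xs)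
  sum-filter-≡ f≡0 [] = refl
  sum-filter-≡ f≡0 (x ∷ xs) with P? x
  ... | yes _ = cong (f x ℕ.+_) (sum-filter-≡ f≡0 xs)
  ... | no ¬px = trans (sum-filter-≡ f≡0 xs) (cong (ℕ._+ sumℕ (map f xs)) (sym (f≡0 x ¬px)))

sumℤ-map-+ : (f : A → ℤ) (g : A → ℕ) → (∀ x → f x ≡ + g x) → ∀ xs → sumℤ (map f xs) ≡ + sumℕ (map g xs)
sumℤ-map-+ f g f≡g [] = refl
sumℤ-map-+ f g f≡g (x ∷ xs) = cong₂ ℤ._+_ (f≡g x) (sumℤ-map-+ f g f≡g xs)

interval : ℕ → ℕ → List ℕ
interval a zero = []
interval a (suc m) = a ∷ interval (suc a) m

applyUpTo-interval : ∀ (f : ℕ → ℕ) a m → (∀ i → f i ≡ a ℕ.+ i) → applyUpTo f m ≡ interval a m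
applyUpTo-interval f a zero _ = refl
applyUpTo-interval f a (suc m) f≗a+ =
  cong₂ _∷_ (trans (f≗a+ 0) (ℕ.+-identityʳ a))
            (applyUpTo-interval (f ∘ suc) (suc a) m (λ i → trans (f≗a+ (suc i)) (ℕ.+-suc a i)))

range≡interval : ∀ a b → range a b ≡ interval a (suc b ∸ a)
range≡interval a b = trans (List.map-upTo (a ℕ.+_) (suc b ∸ a)) (applyUpTo-interval (a ℕ.+_) a _ (λ _ → refl))

count-map-interval : {P : A → Set} {Q : ℕ → Set} (P? : Decidable P) (Q? : Decidable Q) (f : ℕ → A) →
                     (∀ j → P (f (suc j)) ⇔ Q (suc j)) →
                     ∀ a m → count P? (map f (interval (suc a) m)) ≡ count Q? (interval (suc a) m)
count-map-interval P? Q? f P⇔Q a zero = refl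
count-map-interval P? Q? f P⇔Q a (suc m) with P? (f (suc a)) | Q? (suc a)
... | yes _ | yes _ = cong suc (count-map-interval P? Q? f P⇔Q (suc a) m)
... | no _ | no _ = count-map-interval P? Q? f P⇔Q (suc a) m
... | yes p | no ¬q = ⊥-elim (¬q (to (P⇔Q a) p))
... | no ¬p | yes q = ⊥-elim (¬p (from (P⇔Q a) q))

module _ {P : ℕ → Set} (P? : Decidable P) (P-down : ∀ {i j} → i ≤ j → P j → P i) where

  count-interval-none : ∀ {a} m → ¬ P a → count P? (interval a m) ≡ 0
  count-interval-none zero _ = refl
  count-interval-none {a} (suc m) ¬pa with P? a
  ... | yes pa = ⊥-elim (¬pa pa)
  ... | no _ = count-interval-none m (¬pa ∘ P-down (ℕ.n≤1+n a))

  count-interval-≥ : ∀ a m {t} → P t → t ≤ a ℕ.+ m → t ≤ a ℕ.+ count P? (interval (suc a) m)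
  count-interval-≥ a zero pt t≤a+0 = t≤a+0
  count-interval-≥ a (suc m) {t} pt t≤a+m with P? (suc a)
  ... | yes _ = subst (t ≤_) (sym (ℕ.+-suc a _))
                  (count-interval-≥ (suc a) m pt (subst (t ≤_) (ℕ.+-suc a m) t≤a+m))
  ... | no ¬p = ℕ.m≤n⇒m≤n+o _ (ℕ.≮⇒≥ (λ a<t → ¬p (P-down a<t pt)))

  count-interval-sat : ∀ a m → P a → P (a ℕ.+ count P? (interval (suc a) m))
  count-interval-sat a zero pa = subst P (sym (ℕ.+-identityʳ a)) pa
  count-interval-sat a (suc m) pa with P? (suc a)
  ... | yes psa = subst P (sym (ℕ.+-suc a _)) (count-interval-sat (suc a) m psa)
  ... | no ¬psa = subst P (sym (trans (cong (a ℕ.+_) none) (ℕ.+-identityʳ a))) pa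
    where none = count-interval-none m (¬psa ∘ P-down (ℕ.n≤1+n (suc a)))

AllPairs-reverse⁺ : {R : A → A → Set} {xs : List A} → AllPairs R xs → AllPairs (flip R) (reverse xs)
AllPairs-reverse⁺ {xs = []} [] = []
AllPairs-reverse⁺ {R = R} {xs = x ∷ xs} (Rx ∷ Rxs) =
  subst (AllPairs (flip R)) (sym (List.unfold-reverse x xs))
    (AllPairs.++⁺ (AllPairs-reverse⁺ Rxs) ([] ∷ [])
      (All.map (_∷ []) (All-resp-↭ (↭-sym (↭-reverse xs)) Rx)))

module _ (x : ℚ) where

  !!-descending : ∀ D r → AllPairs (flip ℚ._≤_) D →
                  count (x ℚ.<?_) D ≤ r → r < count (x ℚ.≤?_) D → D !! r ≡ just x
  !!-descending [] r [] _ ()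
  !!-descending (d ∷ D) r (d≥D ∷ D↘) c<≤r r<c≤ with x ℚ.<? d | x ℚ.≤? d
  ... | yes x<d | no x≰d = ⊥-elim (x≰d (ℚ.<⇒≤ x<d))
  ... | no _ | no x≰d = ⊥-elim (ℕ.n≮0 (subst (r <_) (trans (count-reject (x ℚ.≤?_) x≰d) none) r<c≤))
    where none = count-none (x ℚ.≤?_) (All.map (λ e≤d x≤e → x≰d (ℚ.≤-trans x≤e e≤d)) d≥D)
  ... | yes x<d | yes x≤d with r
  ...   | zero = ⊥-elim (ℕ.n≮0 (subst (_≤ 0) (count-accept (x ℚ.<?_) x<d) c<≤r))
  ...   | suc r′ = !!-descending D r′ D↘ (ℕ.s≤s⁻¹ (subst (_≤ suc r′) (count-accept (x ℚ.<?_) x<d) c<≤r))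
                                          (ℕ.s≤s⁻¹ (subst (suc r′ <_) (count-accept (x ℚ.≤?_) x≤d) r<c≤))
  !!-descending (d ∷ D) r (d≥D ∷ D↘) c<≤r r<c≤ | no x≮d | yes x≤d
    with ℚ.≤-antisym x≤d (ℚ.≮⇒≥ x≮d) | r
  ... | refl | zero = refl
  ... | refl | suc r′ = !!-descending D r′ D↘ (ℕ.≤-trans (ℕ.≤-reflexive none) z≤n)
                                            (ℕ.s≤s⁻¹ (subst (suc r′ <_) (count-accept (x ℚ.≤?_) x≤d) r<c≤))
    where none = count-none (x ℚ.<?_) (All.map (λ e≤x x<e → ℚ.<-irrefl refl (ℚ.<-≤-trans x<e e≤x)) d≥D)

  ⁽⁾-≡ : ∀ C t → count (x ℚ.<?_) C < t → t ≤ count (x ℚ.≤?_) C → C ⁽ t ⁾ ≡ just x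
  ⁽⁾-≡ C (suc r) c<<t t≤c≤ =
    !!-descending (reverse (sort C)) r C↘
      (subst (_≤ r) (sym (count-sorted (x ℚ.<?_))) (ℕ.s≤s⁻¹ c<<t))
      (subst (r <_) (sym (count-sorted (x ℚ.≤?_))) t≤c≤)
    where
    C↘ : AllPairs (flip ℚ._≤_) (reverse (sort C))
    C↘ = AllPairs-reverse⁺ (Linked⇒AllPairs ℚ.≤-trans (sort-↗ C))
    count-sorted : {P : ℚ → Set} (P? : Decidable P) → count P? (reverse (sort C)) ≡ count P? C
    count-sorted P? = trans (count-↭ P? (↭-reverse (sort C))) (count-↭ P? (sort-↭ C))

  ⁽∸⁾-≡ : ∀ C s k → s ℕ.+ count (x ℚ.<?_) C < k → k ≤ s ℕ.+ count (x ℚ.≤?_) C → C ⁽ k ∸ s ⁾ ≡ just x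
  ⁽∸⁾-≡ C s k s+c<<k k≤s+c≤ =
    ⁽⁾-≡ C (k ∸ s) (ℕ.m+n≤o⇒m≤o∸n (suc _) (subst (_≤ k) (cong suc (ℕ.+-comm s _)) s+c<<k))
                   (ℕ.m≤n+o⇒m∸n≤o k s k≤s+c≤)

≤-/⇔*≤ : ∀ j n d → j ≤ n ℕ./ suc d ⇔ j ℕ.* suc d ≤ n
≤-/⇔*≤ j n d = mk⇔
  (λ j≤n/d → ℕ.≤-trans (ℕ.*-monoˡ-≤ (suc d) j≤n/d) (m/n*n≤m n (suc d)))
  (λ jd≤n → subst (_≤ n ℕ./ suc d) (m*n/n≡m j (suc d)) (/-monoˡ-≤ (suc d) jd≤n))

≤-cong⇔ : ∀ {m n m′ n′} → m ≡ m′ → n ≡ n′ → (m ≤ n) ⇔ (m′ ≤ n′)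
≤-cong⇔ refl refl = ⇔.refl

<-cong⇔ : ∀ {m n m′ n′} → m ≡ m′ → n ≡ n′ → (m < n) ⇔ (m′ < n′)
<-cong⇔ refl refl = ⇔.refl

≤ᵘ⇔ : ∀ a b c d → mkℚᵘ (+ a) b ℚᵘ.≤ mkℚᵘ (+ c) d ⇔ a ℕ.* suc d ≤ c ℕ.* suc b
≤ᵘ⇔ a b c d = mk⇔
  (λ { (*≤* ad≤cb) → ℤ.drop‿+≤+ (subst₂ ℤ._≤_ (sym (ℤ.pos-* a (suc d))) (sym (ℤ.pos-* c (suc b))) ad≤cb) })
  (λ ad≤cb → *≤* (subst₂ ℤ._≤_ (ℤ.pos-* a (suc d)) (ℤ.pos-* c (suc b)) (+≤+ ad≤cb)))

<ᵘ⇔ : ∀ a b c d → mkℚᵘ (+ a) b ℚᵘ.< mkℚᵘ (+ c) d ⇔ a ℕ.* suc d < c ℕ.* suc b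
<ᵘ⇔ a b c d = mk⇔
  (λ { (*<* ad<cb) → ℤ.drop‿+<+ (subst₂ ℤ._<_ (sym (ℤ.pos-* a (suc d))) (sym (ℤ.pos-* c (suc b))) ad<cb) })
  (λ ad<cb → *<* (subst₂ ℤ._<_ (ℤ.pos-* a (suc d)) (ℤ.pos-* c (suc b)) (+<+ ad<cb)))

≤ᵘ-respʳ-≃⇔ : ∀ {p q r} → q ℚᵘ.≃ r → (p ℚᵘ.≤ q) ⇔ (p ℚᵘ.≤ r)
≤ᵘ-respʳ-≃⇔ q≃r = mk⇔ (ℚᵘ.≤-respʳ-≃ q≃r) (ℚᵘ.≤-respʳ-≃ (ℚᵘ.≃-sym q≃r))

<ᵘ-respʳ-≃⇔ : ∀ {p q r} → q ℚᵘ.≃ r → (p ℚᵘ.< q) ⇔ (p ℚᵘ.< r)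
<ᵘ-respʳ-≃⇔ q≃r = mk⇔ (ℚᵘ.<-respʳ-≃ q≃r) (ℚᵘ.<-respʳ-≃ (ℚᵘ.≃-sym q≃r))

≥-floor⇔ : ∀ q j .{{_ : Positive q}} → (+ j ℤ.≤ floor q) ⇔ (mkℚᵘ (+ j) 0 ℚᵘ.≤ toℚᵘ q)
≥-floor⇔ (mkℚ +[1+ n ] d _) j rewrite div-pos-is-/ℕ (+ suc n) (suc d) {{ℕ.nonZero}} =
  ⇔.trans (mk⇔ ℤ.drop‿+≤+ +≤+)
  (⇔.trans (≤-/⇔*≤ j (suc n) d)
  (⇔.trans (≤-cong⇔ refl (sym (ℕ.*-identityʳ (suc n)))) (⇔.sym (≤ᵘ⇔ j 0 (suc n) d))))

toℚᵘ-/ℕ-suc : ∀ L j → toℚᵘ (L /ℕ suc j) ℚᵘ.≃ toℚᵘ L ℚᵘ.* mkℚᵘ (+ 1) j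
toℚᵘ-/ℕ-suc L j = ℚᵘ.≃-trans (ℚ.toℚᵘ-homo-* L _) (ℚᵘ.*-congˡ {toℚᵘ L} (ℚ.toℚᵘ-fromℚᵘ (mkℚᵘ (+ 1) j)))

/ℕ-suc-pos : ∀ L j .{{_ : Positive L}} → Positive (L /ℕ suc j)
/ℕ-suc-pos L j = ℚ.pos*pos⇒pos L (+ 1 ℚ./ suc j) {{ℚ.normalize-pos 1 (suc j)}}

<⇒pos : ∀ {l y} .{{_ : Positive l}} → l ℚ.< y → Positive y
<⇒pos {l} l<y = ℚ.positive (ℚ.<-trans (ℚ.positive⁻¹ l) l<y)

<+1 : ∀ l → l ℚ.< l ℚ.+ 1ℚ
<+1 l = subst (ℚ._< l ℚ.+ 1ℚ) (ℚ.+-identityʳ l) (ℚ.+-monoʳ-< l (ℚ.positive⁻¹ 1ℚ))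

-- For l = c/d and L = a/b in lowest terms, j·l ≤ L (resp. <) reads j·(c·b) ≤ a·d.
Fits FitsStrictly : ℕ → ℚ → ℚ → Set
Fits j l L = j ℕ.* (ℤ.∣ ↥ l ∣ ℕ.* ↧ₙ L) ≤ ℤ.∣ ↥ L ∣ ℕ.* ↧ₙ l
FitsStrictly j l L = j ℕ.* (ℤ.∣ ↥ l ∣ ℕ.* ↧ₙ L) < ℤ.∣ ↥ L ∣ ℕ.* ↧ₙ l

module _ (l L : ℚ) where

  fits? : Decidable (λ j → Fits j l L)
  fits? j = _ ℕ.≤? _

  fitsStrictly? : Decidable (λ j → FitsStrictly j l L)
  fitsStrictly? j = _ ℕ.<? _

  fits-down : ∀ {i j} → i ≤ j → Fits j l L → Fits i l L
  fits-down i≤j = ℕ.≤-trans (ℕ.*-monoˡ-≤ _ i≤j)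

  fitsStrictly-down : ∀ {i j} → i ≤ j → FitsStrictly j l L → FitsStrictly i l L
  fitsStrictly-down i≤j = ℕ.≤-<-trans (ℕ.*-monoˡ-≤ _ i≤j)

  fits-≤ : ∀ {j w} → ¬ Fits (suc w) l L → Fits j l L → j ≤ w
  fits-≤ ¬fits fits = ℕ.≮⇒≥ (λ w<j → ¬fits (fits-down w<j fits))

fits⇒fitsStrictly : ∀ l L j .{{_ : Positive l}} → Fits (suc j) l L → FitsStrictly j l L
fits⇒fitsStrictly (mkℚ +[1+ c ] d _) L j = ℕ.<-≤-trans (ℕ.m<n+m (j ℕ.* _) ℕ.z<s)

fitsStrictly-zero : ∀ l L .{{_ : Positive L}} → FitsStrictly 0 l L
fitsStrictly-zero l (mkℚ +[1+ a ] b _) = ℕ.z<s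

≥-floor-÷⇔ : ∀ L l j .{{_ : Positive L}} .{{_ : Positive l}} →
             (+ j ℤ.≤ floor ((L ÷ l) {{ℚ.pos⇒nonZero l}})) ⇔ Fits j l L
≥-floor-÷⇔ L@(mkℚ +[1+ a ] b _) l@(mkℚ +[1+ c ] d _) j =
  ⇔.trans (≥-floor⇔ (L ℚ.* 1/ l) j {{ℚ.pos*pos⇒pos L (1/ l) {{ℚ.1/pos⇒pos l}}}})
  (⇔.trans (≤ᵘ-respʳ-≃⇔ (ℚ.toℚᵘ-homo-* L (1/ l)))
  (⇔.trans (≤ᵘ⇔ j 0 (suc a ℕ.* suc d) (c ℕ.+ b ℕ.* suc c))
           (≤-cong⇔ (cong (j ℕ.*_) (ℕ.*-comm (suc b) (suc c))) (ℕ.*-identityʳ _))))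

c*[b*j]≡j*[c*b] : ∀ c b j → c ℕ.* (b ℕ.* j) ≡ j ℕ.* (c ℕ.* b)
c*[b*j]≡j*[c*b] c b j = trans (sym (ℕ.*-assoc c b j)) (ℕ.*-comm (c ℕ.* b) j)

≤-/ℕ-suc⇔ : ∀ L l j .{{_ : Positive L}} .{{_ : Positive l}} → (l ℚ.≤ L /ℕ suc j) ⇔ Fits (suc j) l L
≤-/ℕ-suc⇔ L@(mkℚ +[1+ a ] b _) l@(mkℚ +[1+ c ] d _) j =
  ⇔.trans (mk⇔ ℚ.toℚᵘ-mono-≤ ℚ.toℚᵘ-cancel-≤)
  (⇔.trans (≤ᵘ-respʳ-≃⇔ (toℚᵘ-/ℕ-suc L j))
  (⇔.trans (≤ᵘ⇔ (suc c) d (suc a ℕ.* 1) (j ℕ.+ b ℕ.* suc j))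
           (≤-cong⇔ (c*[b*j]≡j*[c*b] (suc c) (suc b) (suc j)) (cong (ℕ._* suc d) (ℕ.*-identityʳ (suc a))))))

<-/ℕ-suc⇔ : ∀ L l j .{{_ : Positive L}} .{{_ : Positive l}} → (l ℚ.< L /ℕ suc j) ⇔ FitsStrictly (suc j) l L
<-/ℕ-suc⇔ L@(mkℚ +[1+ a ] b _) l@(mkℚ +[1+ c ] d _) j =
  ⇔.trans (mk⇔ ℚ.toℚᵘ-mono-< ℚ.toℚᵘ-cancel-<)
  (⇔.trans (<ᵘ-respʳ-≃⇔ (toℚᵘ-/ℕ-suc L j))
  (⇔.trans (<ᵘ⇔ (suc c) d (suc a ℕ.* 1) (j ℕ.+ b ℕ.* suc j))
           (<-cong⇔ (c*[b*j]≡j*[c*b] (suc c) (suc b) (suc j)) (cong (ℕ._* suc d) (ℕ.*-identityʳ (suc a))))))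

⌊_/_⌋ : (L l : ℚ) .{{_ : Positive l}} → ℕ
⌊ L / l ⌋ = ℤ.∣ floor ((L ÷ l) {{ℚ.pos⇒nonZero l}}) ∣

module _ (L l : ℚ) .{{_ : Positive L}} .{{_ : Positive l}} where

  floor-÷≡⌊/⌋ : floor ((L ÷ l) {{ℚ.pos⇒nonZero l}}) ≡ + ⌊ L / l ⌋
  floor-÷≡⌊/⌋ = sym (ℤ.0≤i⇒+∣i∣≡i (from (≥-floor-÷⇔ L l 0) z≤n))

  ≤-⌊/⌋⇔ : ∀ j → j ≤ ⌊ L / l ⌋ ⇔ Fits j l L
  ≤-⌊/⌋⇔ j = ⇔.trans (mk⇔ +≤+ ℤ.drop‿+≤+)
                     (subst (λ z → (+ j ℤ.≤ z) ⇔ Fits j l L) floor-÷≡⌊/⌋ (≥-floor-÷⇔ L l j))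

  ⌊/⌋-fits : Fits ⌊ L / l ⌋ l L
  ⌊/⌋-fits = to (≤-⌊/⌋⇔ _) ℕ.≤-refl

fits-antitone : ∀ L {y z} j .{{_ : Positive L}} .{{_ : Positive y}} .{{_ : Positive z}} →
                y ℚ.≤ z → Fits j z L → Fits j y L
fits-antitone L zero y≤z _ = z≤n
fits-antitone L {y} {z} (suc j) y≤z fits =
  to (≤-/ℕ-suc⇔ L y j) (ℚ.≤-trans y≤z (from (≤-/ℕ-suc⇔ L z j) fits))

⌊/⌋-antitone : ∀ L {y z} .{{_ : Positive L}} .{{_ : Positive y}} .{{_ : Positive z}} →
               y ℚ.≤ z → ⌊ L / z ⌋ ≤ ⌊ L / y ⌋
⌊/⌋-antitone L {y} {z} y≤z = from (≤-⌊/⌋⇔ L y ⌊ L / z ⌋) (fits-antitone L ⌊ L / z ⌋ y≤z (⌊/⌋-fits L z))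

fitsStrictly⇒∃> : ∀ L l j .{{_ : Positive L}} .{{_ : Positive l}} →
                  FitsStrictly j l L → ∃[ y ] l ℚ.< y × Fits j y L
fitsStrictly⇒∃> L l zero _ = l ℚ.+ 1ℚ , <+1 l , z≤n
fitsStrictly⇒∃> L l (suc j) fits< =
  L /ℕ suc j , from (<-/ℕ-suc⇔ L l j) fits< , to (≤-/ℕ-suc⇔ L (L /ℕ suc j) j) ℚ.≤-refl
  where instance _ = /ℕ-suc-pos L j

⌊/⌋≡0 : ∀ L l .{{_ : Positive L}} .{{_ : Positive l}} → ¬ l ℚ.≤ L → ⌊ L / l ⌋ ≡ 0
⌊/⌋≡0 L l l≰L = ℕ.n≤0⇒n≡0 (fits-≤ l L ¬fits₁ (⌊/⌋-fits L l))
  where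
  ¬fits₁ : ¬ Fits 1 l L
  ¬fits₁ fits = l≰L (subst (l ℚ.≤_) (ℚ.*-identityʳ L) (from (≤-/ℕ-suc⇔ L l 0) fits))

row : ℚ → ℕ → ℕ → List ℚ
row L a b = map (L /ℕ_) (range a b)

module _ (L l : ℚ) .{{_ : Positive L}} .{{_ : Positive l}} (a : ℕ) where

  count-≤-row : ∀ b → count (l ℚ.≤?_) (row L (suc a) b) ≡ count (fits? l L) (interval (suc a) (b ∸ a))
  count-≤-row b = trans (cong (count (l ℚ.≤?_) ∘ map (L /ℕ_)) (range≡interval (suc a) b))
                        (count-map-interval (l ℚ.≤?_) (fits? l L) (L /ℕ_) (λ j → ≤-/ℕ-suc⇔ L l j) a (b ∸ a))

  count-<-row : ∀ b → count (l ℚ.<?_) (row L (suc a) b) ≡ count (fitsStrictly? l L) (interval (suc a) (b ∸ a))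
  count-<-row b = trans (cong (count (l ℚ.<?_) ∘ map (L /ℕ_)) (range≡interval (suc a) b))
                        (count-map-interval (l ℚ.<?_) (fitsStrictly? l L) (L /ℕ_) (λ j → <-/ℕ-suc⇔ L l j) a (b ∸ a))

  ⌊/⌋-≤-row : ∀ v → L /ℕ suc v ℚ.≤ l → ⌊ L / l ⌋ ≤ a ℕ.+ count (l ℚ.≤?_) (row L (suc a) (suc v))
  ⌊/⌋-≤-row v L/v≤l =
    subst (⌊ L / l ⌋ ≤_) (cong (a ℕ.+_) (sym (count-≤-row (suc v))))
      (count-interval-≥ (fits? l L) (fits-down l L) a (suc v ∸ a) (⌊/⌋-fits L l)
        (ℕ.≤-trans (fits-≤ l L ¬fits (⌊/⌋-fits L l)) (ℕ.m≤n+m∸n (suc v) a)))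
    where
    ¬fits : ¬ Fits (suc (suc v)) l L
    ¬fits fits = ℚ.<-irrefl refl
      (ℚ.<-≤-trans (from (<-/ℕ-suc⇔ L l v) (fits⇒fitsStrictly l L (suc v) fits)) L/v≤l)

  fitsStrictly-row : ∀ b → FitsStrictly a l L → FitsStrictly (a ℕ.+ count (l ℚ.<?_) (row L (suc a) b)) l L
  fitsStrictly-row b fits< =
    subst (λ c → FitsStrictly (a ℕ.+ c) l L) (sym (count-<-row b))
      (count-interval-sat (fitsStrictly? l L) (fitsStrictly-down l L) a (b ∸ a) fits<)

common-point-above : {Q : A → ℚ → Set} (l : ℚ) → (∀ {x y z} → l ℚ.< y → y ℚ.≤ z → Q x z → Q x y) →
                     {xs : List A} → All (λ x → ∃[ y ] l ℚ.< y × Q x y) xs →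
                     ∃[ y ] l ℚ.< y × All (λ x → Q x y) xs
common-point-above l Q-down [] = l ℚ.+ 1ℚ , <+1 l , []
common-point-above l Q-down ((y , l<y , Qy) ∷ rest) with common-point-above l Q-down rest
... | z , l<z , Qzs with ℚ.≤-total y z
...   | inj₁ y≤z = y , l<y , Qy ∷ All.map (Q-down l<y y≤z) Qzs
...   | inj₂ z≤y = z , l<z , Q-down l<z z≤y Qy ∷ Qzs

module _ {n} (L : Fin n → ℚ) (L-pos : ∀ i → Positive (L i)) (k : ℕ) where

  private instance
    L-pos′ : ∀ {i} → Positive (L i)
    L-pos′ = L-pos _

  M : (y : ℚ) .{{_ : Positive y}} → ℕ
  M y = sumℕ (map (λ i → ⌊ L i / y ⌋) (allFin n))

  m≡M : ∀ y .{{_ : Positive y}} → m L y {{ℚ.pos⇒nonZero y}} ≡ + M y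
  m≡M y = sumℤ-map-+ _ _ (λ i → floor-÷≡⌊/⌋ (L i) y) (allFin n)

  feasible⇒ : ∀ {y} (feasible : Feasible L k y) → k ≤ M y {{proj₁ feasible}}
  feasible⇒ {y} (y-pos , k≤m) = ℤ.drop‿+≤+ (subst (+ k ℤ.≤_) (m≡M y {{y-pos}}) k≤m)

  ⇒feasible : ∀ y (y-pos : Positive y) → k ≤ M y {{y-pos}} → Feasible L k y
  ⇒feasible y y-pos k≤M = y-pos , subst (+ k ℤ.≤_) (sym (m≡M y {{y-pos}})) (+≤+ k≤M)

  M-antitone : ∀ {y z} .{{_ : Positive y}} .{{_ : Positive z}} → y ℚ.≤ z → M z ≤ M y
  M-antitone y≤z = sum-mono-All (All.universal (λ i → ⌊/⌋-antitone (L i) y≤z) (allFin n))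

  module _ {l⋆} (l⋆-max : IsLStar L k l⋆) where

    private instance
      l⋆-pos : Positive l⋆
      l⋆-pos = proj₁ (proj₁ l⋆-max)

    infeasible⇒> : ∀ y → Positive y → Infeasible L k y → l⋆ ℚ.< y
    infeasible⇒> y y-pos infeasible = ℚ.≰⇒> λ y≤l⋆ →
      infeasible (⇒feasible y y-pos (ℕ.≤-trans (feasible⇒ (proj₁ l⋆-max)) (M-antitone {{y-pos}} y≤l⋆)))

    module _ (I : Subset n) (fl fu : Fin n → ℕ) (fl≥1 : ∀ i → i ∈ I → 1 ≤ fl i)
             (adm : Admissible L k l⋆ I fl fu) where

      open Admissible adm

      C : List ℚ
      C = Cset L I fl fu

      s : ℕ
      s = sumℕ (map (λ i → fl i ∸ 1) (elems I))

      ⌊/⌋≡0-outside : ∀ i → i ∉ I → ⌊ L i / l⋆ ⌋ ≡ 0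
      ⌊/⌋≡0-outside i i∉I with outside i i∉I
      ... | L-feasible , L≢l⋆ = ⌊/⌋≡0 (L i) l⋆ (λ l⋆≤L → L≢l⋆ (ℚ.≤-antisym (proj₂ l⋆-max _ L-feasible) l⋆≤L))

      ⌊/⌋-≤-row-inside : ∀ i → i ∈ I → ⌊ L i / l⋆ ⌋ ≤ (fl i ∸ 1) ℕ.+ count (l⋆ ℚ.≤?_) (row (L i) (fl i) (fu i))
      ⌊/⌋-≤-row-inside i i∈I with fl i | fl≥1 i i∈I | fu i | upper i i∈I
      ... | zero  | () | _     | _
      ... | suc a | _  | zero  | () , _
      ... | suc a | _  | suc v | L/v-feasible = ⌊/⌋-≤-row (L i) l⋆ a v (proj₂ l⋆-max _ L/v-feasible)

      k≤s+count≥ : k ≤ s ℕ.+ count (l⋆ ℚ.≤?_) C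
      k≤s+count≥ = begin
        k                                           ≤⟨ feasible⇒ (proj₁ l⋆-max) ⟩
        M l⋆                                        ≡⟨ sum-filter-≡ (_∈? I) _ ⌊/⌋≡0-outside (allFin n) ⟨
        sumℕ (map (λ i → ⌊ L i / l⋆ ⌋) (elems I))  ≤⟨ sum-mono-All (All.map (λ {i} → ⌊/⌋-≤-row-inside i)
                                                                             (all-filter (_∈? I) (allFin n))) ⟩
        sumℕ (map (λ i → (fl i ∸ 1) ℕ.+ count (l⋆ ℚ.≤?_) (row (L i) (fl i) (fu i))) (elems I))
                                                    ≡⟨ sum-+-count (l⋆ ℚ.≤?_) _ _ (elems I) ⟩
        s ℕ.+ count (l⋆ ℚ.≤?_) C                    ∎
        where open ℕ.≤-Reasoning

      g : Fin n → ℕ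
      g i = (fl i ∸ 1) ℕ.+ count (l⋆ ℚ.<?_) (row (L i) (fl i) (fu i))

      g-fitsStrictly : ∀ i → i ∈ I → FitsStrictly (g i) l⋆ (L i)
      g-fitsStrictly i i∈I with fl i | fl≥1 i i∈I | lower i i∈I
      ... | zero        | () | _
      ... | suc zero    | _  | _ = fitsStrictly-row (L i) l⋆ 0 (fu i) (fitsStrictly-zero l⋆ (L i))
      ... | suc (suc a) | _  | inj₁ ()
      ... | suc (suc a) | _  | inj₂ infeasible =
        fitsStrictly-row (L i) l⋆ (suc a) (fu i)
          (to (<-/ℕ-suc⇔ (L i) l⋆ a) (infeasible⇒> _ (/ℕ-suc-pos (L i) a) infeasible))

      ∃>l⋆-g-fits : ∃[ y ] l⋆ ℚ.< y × All (λ i → Fits (g i) y (L i)) (elems I)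
      ∃>l⋆-g-fits = common-point-above l⋆ g-fits-antitone
        (All.map (λ {i} i∈I → fitsStrictly⇒∃> (L i) l⋆ (g i) (g-fitsStrictly i i∈I))
                 (all-filter (_∈? I) (allFin n)))
        where
        g-fits-antitone : ∀ {i y z} → l⋆ ℚ.< y → y ℚ.≤ z → Fits (g i) z (L i) → Fits (g i) y (L i)
        g-fits-antitone {i} l⋆<y y≤z =
          fits-antitone (L i) (g i) {{L-pos i}} {{<⇒pos l⋆<y}} {{<⇒pos (ℚ.<-≤-trans l⋆<y y≤z)}} y≤z

      s+count<≤M : ∀ y .{{_ : Positive y}} → All (λ i → Fits (g i) y (L i)) (elems I) →
                   s ℕ.+ count (l⋆ ℚ.<?_) C ≤ M y
      s+count<≤M y g-fits = begin
        s ℕ.+ count (l⋆ ℚ.<?_) C                   ≡⟨ sum-+-count (l⋆ ℚ.<?_) _ _ (elems I) ⟨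
        sumℕ (map g (elems I))                     ≤⟨ sum-mono-All (All.map (λ {i} → from (≤-⌊/⌋⇔ (L i) y (g i))) g-fits) ⟩
        sumℕ (map (λ i → ⌊ L i / y ⌋) (elems I))  ≤⟨ sum-filter-≤ (_∈? I) _ (allFin n) ⟩
        M y                                        ∎
        where open ℕ.≤-Reasoning

      s+count<<k : s ℕ.+ count (l⋆ ℚ.<?_) C < k
      s+count<<k = let y , l⋆<y , g-fits = ∃>l⋆-g-fits; instance y-pos = <⇒pos l⋆<y in
        ℕ.≰⇒> λ k≤s+c → ℚ.<-irrefl refl (ℚ.<-≤-trans l⋆<y
          (proj₂ l⋆-max y (⇒feasible y y-pos (ℕ.≤-trans k≤s+c (s+count<≤M y g-fits)))))

corollary3 : (n : ℕ) (L : Fin n → ℚ) → (∀ i → Positive (L i)) →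
             (k : ℕ) → 1 ≤ k →
             (l⋆ : ℚ) → IsLStar L k l⋆ →
             (I : Subset n) (fl fu : Fin n → ℕ) →
             (∀ i → i ∈ I → 1 ≤ fl i) →
             Admissible L k l⋆ I fl fu →
             Cset L I fl fu ⁽ k ∸ sumℕ (map (λ i → fl i ∸ 1) (elems I)) ⁾ ≡ just l⋆
corollary3 n L L-pos k _ l⋆ l⋆-max I fl fu fl≥1 adm =
  ⁽∸⁾-≡ l⋆ (Cset L I fl fu) _ k
    (s+count<<k L L-pos k l⋆-max I fl fu fl≥1 adm)
    (k≤s+count≥ L L-pos k l⋆-max I fl fu fl≥1 adm)
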